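{- Let $\overrightarrow{G}$ be a digraph with no loops or parallel arcs, with vertex set $V(\overrightarrow{G})=\{v_1,\dots,v_n\}$ and arc set $E(\overrightarrow{G})=\{\overrightarrow{e_1},\dots,\overrightarrow{e_m}\}$, and let $1\le k\le n$. For $M\in\{A,L,Q\}$ let $\Phi^M_k(\overrightarrow{G},x)=d_{(k,1^{n-k})}(xI_n-M(\overrightarrow{G}))$ and let $\Phi'^M_k(\overrightarrow{G},x)$ denote its derivative with respect to $x$. Then $$(m-n)\Phi^M_k(\overrightarrow{G},x)+x\,\Phi'^M_k(\overrightarrow{G},x)=\sum_{\overrightarrow{e}\in E(\overrightarrow{G})}\Phi^M_k(\overrightarrow{G}-\overrightarrow{e},x).$$
   Context: For a partition $\lambda$ of $n$ with irreducible character $\chi_\lambda$ of the symmetric group $S_n$, the immanant of an $n\times n$ matrix $B=(b_{ij})$ is $d_\lambda(B)=\sum_{\sigma\in S_n}\chi_\lambda(\sigma)\prod_{i=1}^n b_{i\sigma(i)}$; for the hook partition $\lambda=(k,1^{n-k})$ this is the hook immanant. For a digraph $\overrightarrow{G}$: $A(\overrightarrow{G})=(a_{ij})$ with $a_{ij}=1$ if $(v_i,v_j)$ is an arc and $0$ otherwise; $D(\overrightarrow{G})=\mathrm{diag}(d^-(v_1),\dots,d^-(v_n))$ where $d^-(v_i)$ is the in-degree of $v_i$; $L(\overrightarrow{G})=D(\overrightarrow{G})-A(\overrightarrow{G})$ and $Q(\overrightarrow{G})=D(\overrightarrow{G})+A(\overrightarrow{G})$. $\overrightarrow{G}-\overrightarrow{e}$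 is the digraph obtained by deleting the arc $\overrightarrow{e}$ and keeping all vertices and other arcs (its matrices $A,D,L,Q$ are computed for the new digraph). -}

module Defs where

open import Data.Nat as ℕ using (ℕ; zero; suc; _∸_; _≤ᵇ_)
open import Data.Integer using (ℤ; +_; -_; _+_; _*_)
open import Data.Fin using (Fin; _≟_; _<?_)
open import Data.Bool using (Bool; true; false; if_then_else_; _∧_; _∨_; not)
open import Data.List using (List; []; _∷_; map; foldr; concatMap; length; allFin; upTo; filterᵇ)
open import Data.Vec using (Vec; []; _∷_; lookup)
open import Data.Product using (_×_; _,_)
open import Relation.Binary.PropositionalEquality using (_≡_)
open import Relation.Nullary.Decidable using (⌊_⌋)

sumℤ : List ℤ → ℤ
sumℤ = foldr _+_ (+ 0)

allᵇ : {A : Set} → (A → Bool) → List A → Bool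
allᵇ p = foldr (λ x b → p x ∧ b) true

countᵇ : {A : Set} → (A → Bool) → List A → ℕ
countᵇ p xs = length (filterᵇ p xs)

sgnPow : ℕ → ℤ
sgnPow zero = + 1
sgnPow (suc k) = - sgnPow k

-- Polynomials in x over ℤ, as coefficient sequences (coefficient of x^d)

Poly : Set
Poly = ℕ → ℤ

0ₚ : Poly
0ₚ _ = + 0

constₚ : ℤ → Poly
constₚ c zero = c
constₚ c (suc _) = + 0

Xₚ : Poly
Xₚ (suc zero) = + 1
Xₚ _ = + 0

_+ₚ_ : Poly → Poly → Poly
(p +ₚ q) d = p d + q d

_·ₚ_ : ℤ → Poly → Poly
(c ·ₚ p) d = c * p d

_*ₚ_ : Poly → Poly → Poly
(p *ₚ q) d = sumℤ (map (λ i → p i * q (d ∸ i)) (upTo (suc d)))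

deriv : Poly → Poly
deriv p d = + (suc d) * p (suc d)

sumₚ : List Poly → Poly
sumₚ = foldr _+ₚ_ 0ₚ

prodₚ : List Poly → Poly
prodₚ = foldr _*ₚ_ (constₚ (+ 1))

allVecs : {A : Set} → List A → (m : ℕ) → List (Vec A m)
allVecs xs zero = [] ∷ []
allVecs xs (suc m) = concatMap (λ x → map (x ∷_) (allVecs xs m)) xs

allMaps : (n : ℕ) → List (Fin n → Fin n)
allMaps n = map lookup (allVecs (allFin n) n)

isInjective : {n : ℕ} → (Fin n → Fin n) → Bool
isInjective {n} σ =
  allᵇ (λ i → allᵇ (λ j → ⌊ i ≟ j ⌋ ∨ not ⌊ σ i ≟ σ j ⌋) (allFin n)) (allFin n)

-- subsets of Fin n as characteristic vectors
allSubsets : (n : ℕ) → List (Vec Bool n)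
allSubsets n = allVecs (true ∷ false ∷ []) n

size : {n : ℕ} → Vec Bool n → ℕ
size {n} S = countᵇ (lookup S) (allFin n)

isInvariant : {n : ℕ} → (Fin n → Fin n) → Vec Bool n → Bool
isInvariant {n} σ S = allᵇ (λ i → not (lookup S i) ∨ lookup S (σ i)) (allFin n)

-- number of inversions of σ restricted to S:
-- #{(i , j) | i , j ∈ S , i < j , σ j < σ i}; if σ(S) = S, (-1)^this is sgn(σ|S)
invs : {n : ℕ} → (Fin n → Fin n) → Vec Bool n → ℕ
invs {n} σ S =
  foldr ℕ._+_ 0
    (map (λ i → countᵇ (λ j → lookup S i ∧ lookup S j ∧ ⌊ i <? j ⌋ ∧ ⌊ σ j <? σ i ⌋) (allFin n))
         (allFin n))

-- Hook character χ_(k,1^(n-k)) of S_n, evaluated at a permutation σ.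
-- χ_(k,1^(n-k)) is the character of Λ^(n-k) of the standard representation,
-- computed as Σ_{i=0}^{n-k} (-1)^(n-k-i) tr Λ^i(P_σ), where
-- tr Λ^i(P_σ) = Σ_{|S| = i, σ(S) = S} sgn(σ|S).

χhook : (n k : ℕ) → (Fin n → Fin n) → ℤ
χhook n k σ =
  sumℤ (map (λ S → if isInvariant σ S ∧ (size S ≤ᵇ (n ∸ k))
                   then sgnPow (((n ∸ k) ∸ size S) ℕ.+ invs σ S)
                   else + 0)
            (allSubsets n))

-- hook immanant d_(k,1^(n-k))(B) of an n×n matrix with entries in ℤ[x];
-- the sum over S_n is the sum over injective maps Fin n → Fin n.
hookImm : {n : ℕ} → ℕ → (Fin n → Fin n → Poly) → Poly
hookImm {n} k B =
  sumₚ (map (λ σ → if isInjective σ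
                   then χhook n k σ ·ₚ prodₚ (map (λ i → B i (σ i)) (allFin n))
                   else 0ₚ)
            (allMaps n))

-- Digraphs on vertex set Fin n (no parallel arcs by construction):
-- G i j ≡ true iff (v_i , v_j) is an arc.

Digraph : ℕ → Set
Digraph n = Fin n → Fin n → Bool

Loopless : {n : ℕ} → Digraph n → Set
Loopless {n} G = (i : Fin n) → G i i ≡ false

arcs : {n : ℕ} → Digraph n → List (Fin n × Fin n)
arcs {n} G = filterᵇ (λ { (i , j) → G i j })
                     (concatMap (λ i → map (λ j → (i , j)) (allFin n)) (allFin n))

deleteArc : {n : ℕ} → Digraph n → Fin n × Fin n → Digraph n
deleteArc G (a , b) i j = G i j ∧ not (⌊ i ≟ a ⌋ ∧ ⌊ j ≟ b ⌋)

inDeg : {n : ℕ} → Digraph n → Fin n → ℕ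
inDeg {n} G j = countᵇ (λ i → G i j) (allFin n)

adjM : {n : ℕ} → Digraph n → Fin n → Fin n → ℤ
adjM G i j = if G i j then + 1 else + 0

degM : {n : ℕ} → Digraph n → Fin n → Fin n → ℤ
degM G i j = if ⌊ i ≟ j ⌋ then + (inDeg G i) else + 0

data MatKind : Set where
  A L Q : MatKind

matrix : {n : ℕ} → MatKind → Digraph n → Fin n → Fin n → ℤ
matrix A G i j = adjM G i j
matrix L G i j = degM G i j + (- adjM G i j)
matrix Q G i j = degM G i j + adjM G i j

charMatrix : {n : ℕ} → MatKind → Digraph n → Fin n → Fin n → Poly
charMatrix M G i j = (if ⌊ i ≟ j ⌋ then Xₚ else 0ₚ) +ₚ constₚ (- matrix M G i j)

Φ : {n : ℕ} → MatKind → ℕ → Digraph n → Poly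
Φ M k G = hookImm k (charMatrix M G)

{-# OPTIONS --safe #-}
-- The entries of M(G) are sums of contributions of single arcs: the arc (u , v) contributes to A
-- at (u , v) and to D at (v , v).  Hence Σ_e M(G − e) = (m − 1) M(G), and since x d/dx of an entry
-- of xI − M(G) is its x-part, every such entry c satisfies Σ_e c(G − e) = (m − 1) c + x c′.
-- For a permutation σ, deleting an arc changes at most one factor of ∏_i (xI − M)_{i σ(i)}, so the
-- product rule for x d/dx turns the entrywise identity into Σ_e ∏(G − e) = (m − n) ∏ + x ∏′;
-- summing against the hook character gives the theorem.
module Submission where

open import Defs
open import Data.Nat using (ℕ; _≤_)
open import Data.Integer using (+_; _-_)
open import Data.List using (map; length)
open import Relation.Binary.PropositionalEquality using (_≡_)

open import Data.Bool using (Bool; true; false; if_then_else_; _∧_; _∨_; not)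
open import Data.Bool.Properties using (∧-identityʳ)
open import Data.Empty using (⊥-elim)
open import Data.Fin using (Fin; _≟_)
open import Data.Integer using (ℤ; -_; _+_; _*_)
import Data.Integer.Properties as ℤ
open import Algebra.Properties.CommutativeSemigroup ℤ.+-commutativeSemigroup using (interchange)
open import Data.Integer.Tactic.RingSolver using (solve-∀)
open import Data.List using (List; []; _∷_; _++_; concatMap; filterᵇ; allFin; upTo; applyUpTo)
import Data.List.Properties as List
open import Data.List.Membership.Propositional using (_∈_)
open import Data.List.Membership.Propositional.Properties using (∈-allFin)
open import Data.List.Relation.Unary.All as All using (All; []; _∷_)
import Data.List.Relation.Unary.All.Properties as All
open import Data.List.Relation.Unary.Any using (here; there)
open import Data.List.Relation.Unary.Unique.Propositional using (Unique; []; _∷_)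
open import Data.List.Relation.Unary.Unique.Propositional.Properties using (allFin⁺)
open import Data.Nat using (zero; suc; _∸_; _<_; s≤s)
import Data.Nat.Properties as ℕ
open import Data.Product using (_×_; _,_)
open import Function using (_∘_; id)
open import Function.Definitions using (Injective)
open import Relation.Binary.Definitions using (DecidableEquality)
open import Relation.Binary.PropositionalEquality using (_≢_; refl; sym; trans; cong; cong₂; module ≡-Reasoning)
open import Relation.Nullary using (yes; no; contradiction)
open import Relation.Nullary.Decidable using (⌊_⌋)

open ≡-Reasoning

𝟙 : Bool → ℤ
𝟙 b = if b then + 1 else + 0

𝟙-∧ : ∀ a b → 𝟙 (a ∧ b) ≡ 𝟙 a * 𝟙 b
𝟙-∧ true  b = sym (ℤ.*-identityˡ (𝟙 b))
𝟙-∧ false b = refl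

𝟙-∧-not : ∀ a b → 𝟙 a - 𝟙 (a ∧ not b) ≡ 𝟙 b * 𝟙 a
𝟙-∧-not true  true  = refl
𝟙-∧-not true  false = refl
𝟙-∧-not false true  = refl
𝟙-∧-not false false = refl

𝟙-idem : ∀ b → 𝟙 b * 𝟙 b ≡ 𝟙 b
𝟙-idem true  = refl
𝟙-idem false = refl

module _ {A : Set} where

  sumℤ-map-cong : ∀ {f g : A → ℤ} → (∀ x → f x ≡ g x) → ∀ xs → sumℤ (map f xs) ≡ sumℤ (map g xs)
  sumℤ-map-cong f≗g xs = cong sumℤ (List.map-cong f≗g xs)

  sumℤ-map-vanishing : ∀ {f : A → ℤ} {xs} → All (λ x → f x ≡ + 0) xs → sumℤ (map f xs) ≡ + 0
  sumℤ-map-vanishing []           = refl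
  sumℤ-map-vanishing (fx≡0 ∷ all) = cong₂ _+_ fx≡0 (sumℤ-map-vanishing all)

  sumℤ-map-+ : ∀ (f g : A → ℤ) xs →
    sumℤ (map (λ x → f x + g x) xs) ≡ sumℤ (map f xs) + sumℤ (map g xs)
  sumℤ-map-+ f g []       = refl
  sumℤ-map-+ f g (x ∷ xs) =
    trans (cong (_+_ (f x + g x)) (sumℤ-map-+ f g xs)) (interchange (f x) (g x) _ _)

  sumℤ-map-*ˡ : ∀ c (f : A → ℤ) xs → sumℤ (map (λ x → c * f x) xs) ≡ c * sumℤ (map f xs)
  sumℤ-map-*ˡ c f []       = sym (ℤ.*-zeroʳ c)
  sumℤ-map-*ˡ c f (x ∷ xs) =
    trans (cong (_+_ (c * f x)) (sumℤ-map-*ˡ c f xs)) (sym (ℤ.*-distribˡ-+ c (f x) _))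

  sumℤ-map-neg : ∀ (f : A → ℤ) xs → sumℤ (map (λ x → - f x) xs) ≡ - sumℤ (map f xs)
  sumℤ-map-neg f []       = refl
  sumℤ-map-neg f (x ∷ xs) =
    trans (cong (_+_ (- f x)) (sumℤ-map-neg f xs)) (sym (ℤ.neg-distrib-+ (f x) _))

  sumℤ-map-- : ∀ (f g : A → ℤ) xs →
    sumℤ (map (λ x → f x - g x) xs) ≡ sumℤ (map f xs) - sumℤ (map g xs)
  sumℤ-map-- f g xs =
    trans (sumℤ-map-+ f (λ x → - g x) xs) (cong (_+_ (sumℤ (map f xs))) (sumℤ-map-neg g xs))

  sumℤ-map-const : ∀ c (xs : List A) → sumℤ (map (λ _ → c) xs) ≡ + length xs * c
  sumℤ-map-const c []       = sym (ℤ.*-zeroˡ c)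
  sumℤ-map-const c (x ∷ xs) =
    trans (cong (_+_ c) (sumℤ-map-const c xs)) (sym (ℤ.suc-* (+ length xs) c))

  sumℤ-map-0 : ∀ (xs : List A) → sumℤ (map (λ _ → + 0) xs) ≡ + 0
  sumℤ-map-0 xs = trans (sumℤ-map-const (+ 0) xs) (ℤ.*-zeroʳ (+ length xs))

  sumℤ-++ : ∀ (f : A → ℤ) xs ys → sumℤ (map f (xs ++ ys)) ≡ sumℤ (map f xs) + sumℤ (map f ys)
  sumℤ-++ f []       ys = sym (ℤ.+-identityˡ _)
  sumℤ-++ f (x ∷ xs) ys = trans (cong (_+_ (f x)) (sumℤ-++ f xs ys)) (sym (ℤ.+-assoc (f x) _ _))

  sumℤ-filterᵇ : ∀ (p : A → Bool) (f : A → ℤ) xs →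
    sumℤ (map f (filterᵇ p xs)) ≡ sumℤ (map (λ x → 𝟙 (p x) * f x) xs)
  sumℤ-filterᵇ p f []       = refl
  sumℤ-filterᵇ p f (x ∷ xs) with p x
  ... | true  = cong₂ _+_ (sym (ℤ.*-identityˡ (f x))) (sumℤ-filterᵇ p f xs)
  ... | false = trans (sumℤ-filterᵇ p f xs) (sym (ℤ.+-identityˡ _))

  countᵇ-as-sumℤ : ∀ (p : A → Bool) xs → + countᵇ p xs ≡ sumℤ (map (𝟙 ∘ p) xs)
  countᵇ-as-sumℤ p []       = refl
  countᵇ-as-sumℤ p (x ∷ xs) with p x
  ... | true  = cong (_+_ (+ 1)) (countᵇ-as-sumℤ p xs)
  ... | false = trans (countᵇ-as-sumℤ p xs) (sym (ℤ.+-identityˡ _))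

module _ {A B : Set} where

  sumℤ-concatMap : ∀ (f : B → ℤ) (g : A → List B) xs →
    sumℤ (map f (concatMap g xs)) ≡ sumℤ (map (λ x → sumℤ (map f (g x))) xs)
  sumℤ-concatMap f g []       = refl
  sumℤ-concatMap f g (x ∷ xs) =
    trans (sumℤ-++ f (g x) (concatMap g xs)) (cong (_+_ (sumℤ (map f (g x)))) (sumℤ-concatMap f g xs))

  sumℤ-map-swap : ∀ (f : A → B → ℤ) xs ys →
    sumℤ (map (λ x → sumℤ (map (f x) ys)) xs) ≡ sumℤ (map (λ y → sumℤ (map (λ x → f x y) xs)) ys)
  sumℤ-map-swap f []       ys = sym (sumℤ-map-0 ys)
  sumℤ-map-swap f (x ∷ xs) ys =
    trans (cong (_+_ (sumℤ (map (f x) ys))) (sumℤ-map-swap f xs ys))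
          (sym (sumℤ-map-+ (f x) (λ y → sumℤ (map (λ x → f x y) xs)) ys))

-- Polynomials and the Euler operator x d/dx

infix 4 _≈ₚ_
_≈ₚ_ : Poly → Poly → Set
p ≈ₚ q = ∀ d → p d ≡ q d

euler : Poly → Poly
euler p d = + d * p d

shiftedEuler : ℤ → Poly → Poly
shiftedEuler c p = (c ·ₚ p) +ₚ euler p

sumₚ-map-cong : ∀ {A : Set} {f g : A → Poly} → (∀ x → f x ≈ₚ g x) → ∀ xs → sumₚ (map f xs) ≈ₚ sumₚ (map g xs)
sumₚ-map-cong f≈g []       d = refl
sumₚ-map-cong f≈g (x ∷ xs) d = cong₂ _+_ (f≈g x d) (sumₚ-map-cong f≈g xs d)

sumₚ-apply : ∀ {A : Set} (f : A → Poly) xs d → sumₚ (map f xs) d ≡ sumℤ (map (λ x → f x d) xs)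
sumₚ-apply f []       d = refl
sumₚ-apply f (x ∷ xs) d = cong (_+_ (f x d)) (sumₚ-apply f xs d)

sumℤ-upTo-cong : ∀ {f g : ℕ → ℤ} n → (∀ {i} → i < n → f i ≡ g i) →
  sumℤ (map f (upTo n)) ≡ sumℤ (map g (upTo n))
sumℤ-upTo-cong n f≡g = cong sumℤ (List.map-cong-local (All.applyUpTo⁺₁ _ n f≡g))

*ₚ-cong : ∀ {p p′ q q′} → p ≈ₚ p′ → q ≈ₚ q′ → p *ₚ q ≈ₚ p′ *ₚ q′
*ₚ-cong p≈p′ q≈q′ d = sumℤ-map-cong (λ i → cong₂ _*_ (p≈p′ i) (q≈q′ (d ∸ i))) (upTo (suc d))

*ₚ-congˡ : ∀ p {q q′} → q ≈ₚ q′ → p *ₚ q ≈ₚ p *ₚ q′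
*ₚ-congˡ p q≈q′ d = sumℤ-map-cong (λ i → cong (p i *_) (q≈q′ (d ∸ i))) (upTo (suc d))

*ₚ-congʳ : ∀ q {p p′} → p ≈ₚ p′ → p *ₚ q ≈ₚ p′ *ₚ q
*ₚ-congʳ q p≈p′ d = sumℤ-map-cong (λ i → cong (_* q (d ∸ i)) (p≈p′ i)) (upTo (suc d))

*ₚ-distribˡ-+ₚ : ∀ p q r → p *ₚ (q +ₚ r) ≈ₚ (p *ₚ q) +ₚ (p *ₚ r)
*ₚ-distribˡ-+ₚ p q r d =
  trans (sumℤ-map-cong (λ i → ℤ.*-distribˡ-+ (p i) (q (d ∸ i)) (r (d ∸ i))) (upTo (suc d)))
        (sumℤ-map-+ (λ i → p i * q (d ∸ i)) (λ i → p i * r (d ∸ i)) (upTo (suc d)))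

*ₚ-distribʳ-+ₚ : ∀ p q r → (q +ₚ r) *ₚ p ≈ₚ (q *ₚ p) +ₚ (r *ₚ p)
*ₚ-distribʳ-+ₚ p q r d =
  trans (sumℤ-map-cong (λ i → ℤ.*-distribʳ-+ (p (d ∸ i)) (q i) (r i)) (upTo (suc d)))
        (sumℤ-map-+ (λ i → q i * p (d ∸ i)) (λ i → r i * p (d ∸ i)) (upTo (suc d)))

·ₚ-*ₚ : ∀ c p q → (c ·ₚ p) *ₚ q ≈ₚ c ·ₚ (p *ₚ q)
·ₚ-*ₚ c p q d =
  trans (sumℤ-map-cong (λ i → ℤ.*-assoc c (p i) (q (d ∸ i))) (upTo (suc d)))
        (sumℤ-map-*ˡ c (λ i → p i * q (d ∸ i)) (upTo (suc d)))

*ₚ-·ₚ : ∀ c p q → p *ₚ (c ·ₚ q) ≈ₚ c ·ₚ (p *ₚ q)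
*ₚ-·ₚ c p q d =
  trans (sumℤ-map-cong (λ i → swap (p i) c (q (d ∸ i))) (upTo (suc d)))
        (sumℤ-map-*ˡ c (λ i → p i * q (d ∸ i)) (upTo (suc d)))
  where
  swap : ∀ a c b → a * (c * b) ≡ c * (a * b)
  swap = solve-∀

*ₚ-sumₚ : ∀ {A : Set} p (f : A → Poly) xs → p *ₚ sumₚ (map f xs) ≈ₚ sumₚ (map (λ x → p *ₚ f x) xs)
*ₚ-sumₚ p f []       d =
  trans (sumℤ-map-cong (λ i → ℤ.*-zeroʳ (p i)) (upTo (suc d)))
        (sumℤ-map-0 (upTo (suc d)))
*ₚ-sumₚ p f (x ∷ xs) d =
  trans (*ₚ-distribˡ-+ₚ p (f x) (sumₚ (map f xs)) d) (cong (_+_ ((p *ₚ f x) d)) (*ₚ-sumₚ p f xs d))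

sumₚ-*ₚ : ∀ {A : Set} p (f : A → Poly) xs → sumₚ (map f xs) *ₚ p ≈ₚ sumₚ (map (λ x → f x *ₚ p) xs)
sumₚ-*ₚ p f []       d =
  trans (sumℤ-map-cong (λ i → ℤ.*-zeroˡ (p (d ∸ i))) (upTo (suc d)))
        (sumℤ-map-0 (upTo (suc d)))
sumₚ-*ₚ p f (x ∷ xs) d =
  trans (*ₚ-distribʳ-+ₚ p (f x) (sumₚ (map f xs)) d) (cong (_+_ ((f x *ₚ p) d)) (sumₚ-*ₚ p f xs d))

euler-*ₚ : ∀ p q → euler (p *ₚ q) ≈ₚ (euler p *ₚ q) +ₚ (p *ₚ euler q)
euler-*ₚ p q d = begin
  + d * (p *ₚ q) d
    ≡⟨ sym (sumℤ-map-*ˡ (+ d) (λ i → p i * q (d ∸ i)) (upTo (suc d))) ⟩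
  sumℤ (map (λ i → + d * (p i * q (d ∸ i))) (upTo (suc d)))
    ≡⟨ sumℤ-upTo-cong (suc d) split ⟩
  sumℤ (map (λ i → (+ i * p i) * q (d ∸ i) + p i * (+ (d ∸ i) * q (d ∸ i))) (upTo (suc d)))
    ≡⟨ sumℤ-map-+ (λ i → (+ i * p i) * q (d ∸ i)) (λ i → p i * (+ (d ∸ i) * q (d ∸ i))) (upTo (suc d)) ⟩
  (euler p *ₚ q) d + (p *ₚ euler q) d ∎
  where
  distribute : ∀ a b x y → (a + b) * (x * y) ≡ (a * x) * y + x * (b * y)
  distribute = solve-∀
  split : ∀ {i} → i < suc d → + d * (p i * q (d ∸ i)) ≡ (+ i * p i) * q (d ∸ i) + p i * (+ (d ∸ i) * q (d ∸ i))
  split {i} (s≤s i≤d) = trans (cong (λ m → + m * (p i * q (d ∸ i))) (sym (ℕ.m+[n∸m]≡n i≤d)))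
                              (distribute (+ i) (+ (d ∸ i)) (p i) (q (d ∸ i)))

shiftedEuler-*ₚ : ∀ a b p q →
  shiftedEuler (a + b) (p *ₚ q) ≈ₚ (shiftedEuler a p *ₚ q) +ₚ (p *ₚ shiftedEuler b q)
shiftedEuler-*ₚ a b p q d = begin
  (a + b) * pq + + d * pq
    ≡⟨ cong (_+_ ((a + b) * pq)) (euler-*ₚ p q d) ⟩
  (a + b) * pq + (ep*q + p*eq)
    ≡⟨ regroup a b pq ep*q p*eq ⟩
  (a * pq + ep*q) + (b * pq + p*eq)
    ≡⟨ sym (cong₂ _+_ (trans (*ₚ-distribʳ-+ₚ q (a ·ₚ p) (euler p) d) (cong (λ x → x + ep*q) (·ₚ-*ₚ a p q d)))
                      (trans (*ₚ-distribˡ-+ₚ p (b ·ₚ q) (euler q) d) (cong (λ x → x + p*eq) (*ₚ-·ₚ b p q d)))) ⟩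
  (shiftedEuler a p *ₚ q) d + (p *ₚ shiftedEuler b q) d ∎
  where
  pq ep*q p*eq : ℤ
  pq = (p *ₚ q) d
  ep*q = (euler p *ₚ q) d
  p*eq = (p *ₚ euler q) d
  regroup : ∀ a b x y z → (a + b) * x + (y + z) ≡ (a * x + y) + (b * x + z)
  regroup = solve-∀

Xₚ-*ₚ-deriv : ∀ p → Xₚ *ₚ deriv p ≈ₚ euler p
Xₚ-*ₚ-deriv p zero    = refl
Xₚ-*ₚ-deriv p (suc d) = begin
  + 0 + (+ 1 * q d + higher)  ≡⟨ ℤ.+-identityˡ _ ⟩
  + 1 * q d + higher          ≡⟨ cong (_+_ (+ 1 * q d)) (sumℤ-map-vanishing (All.applyUpTo⁺₂ _ d (λ _ → refl))) ⟩
  + 1 * q d + + 0             ≡⟨ ℤ.+-identityʳ _ ⟩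
  + 1 * q d                   ≡⟨ ℤ.*-identityˡ _ ⟩
  q d ∎
  where
  q : Poly
  q = deriv p
  higher : ℤ
  higher = sumℤ (map (λ i → Xₚ i * q (suc d ∸ i)) (applyUpTo (λ i → suc (suc i)) d))

euler-constₚ : ∀ c → euler (constₚ c) ≈ₚ 0ₚ
euler-constₚ c zero    = refl
euler-constₚ c (suc d) = ℤ.*-zeroʳ (+ suc d)

euler-Xₚ : euler Xₚ ≈ₚ Xₚ
euler-Xₚ zero          = refl
euler-Xₚ (suc zero)    = refl
euler-Xₚ (suc (suc d)) = ℤ.*-zeroʳ (+ suc (suc d))

constₚ-+ : ∀ a b → constₚ (a + b) ≈ₚ constₚ a +ₚ constₚ b
constₚ-+ a b zero    = refl
constₚ-+ a b (suc d) = refl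

constₚ-zero : constₚ (+ 0) ≈ₚ 0ₚ
constₚ-zero zero    = refl
constₚ-zero (suc d) = refl

sumℤ-map-constₚ : ∀ {A : Set} (a : A → ℤ) xs d →
  sumℤ (map (λ x → constₚ (a x) d) xs) ≡ constₚ (sumℤ (map a xs)) d
sumℤ-map-constₚ a xs zero    = refl
sumℤ-map-constₚ a xs (suc d) = sumℤ-map-0 xs

sumₚ-shiftedEuler : ∀ {A : Set} c (f : A → Poly) xs →
  sumₚ (map (λ x → shiftedEuler c (f x)) xs) ≈ₚ shiftedEuler c (sumₚ (map f xs))
sumₚ-shiftedEuler c f xs d = begin
  sumₚ (map (λ x → shiftedEuler c (f x)) xs) d
    ≡⟨ sumₚ-apply (λ x → shiftedEuler c (f x)) xs d ⟩
  sumℤ (map (λ x → c * f x d + + d * f x d) xs)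
    ≡⟨ sumℤ-map-+ (λ x → c * f x d) (λ x → + d * f x d) xs ⟩
  sumℤ (map (λ x → c * f x d) xs) + sumℤ (map (λ x → + d * f x d) xs)
    ≡⟨ cong₂ _+_ (sumℤ-map-*ˡ c (λ x → f x d) xs) (sumℤ-map-*ˡ (+ d) (λ x → f x d) xs) ⟩
  c * sumℤ (map (λ x → f x d) xs) + + d * sumℤ (map (λ x → f x d) xs)
    ≡⟨ sym (cong (λ s → c * s + + d * s) (sumₚ-apply f xs d)) ⟩
  shiftedEuler c (sumₚ (map f xs)) d ∎

sumₚ-·ₚ : ∀ {A : Set} c (f : A → Poly) xs → sumₚ (map (λ x → c ·ₚ f x) xs) ≈ₚ c ·ₚ sumₚ (map f xs)
sumₚ-·ₚ c f xs d =
  trans (sumₚ-apply (λ x → c ·ₚ f x) xs d)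
        (trans (sumℤ-map-*ˡ c (λ x → f x d) xs) (cong (c *_) (sym (sumₚ-apply f xs d))))

shiftedEuler-·ₚ : ∀ a c p → c ·ₚ shiftedEuler a p ≈ₚ shiftedEuler a (c ·ₚ p)
shiftedEuler-·ₚ a c p d = commute a c (+ d) (p d)
  where
  commute : ∀ a c D x → c * (a * x + D * x) ≡ a * (c * x) + D * (c * x)
  commute = solve-∀

sumₚ-swap : ∀ {A B : Set} (f : A → B → Poly) xs ys →
  sumₚ (map (λ x → sumₚ (map (f x) ys)) xs) ≈ₚ sumₚ (map (λ y → sumₚ (map (λ x → f x y) xs)) ys)
sumₚ-swap f xs ys d = begin
  sumₚ (map (λ x → sumₚ (map (f x) ys)) xs) d
    ≡⟨ sumₚ-apply (λ x → sumₚ (map (f x) ys)) xs d ⟩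
  sumℤ (map (λ x → sumₚ (map (f x) ys) d) xs)
    ≡⟨ sumℤ-map-cong (λ x → sumₚ-apply (f x) ys d) xs ⟩
  sumℤ (map (λ x → sumℤ (map (λ y → f x y d) ys)) xs)
    ≡⟨ sumℤ-map-swap (λ x y → f x y d) xs ys ⟩
  sumℤ (map (λ y → sumℤ (map (λ x → f x y d) xs)) ys)
    ≡⟨ sym (sumℤ-map-cong (λ y → sumₚ-apply (λ x → f x y) xs d) ys) ⟩
  sumℤ (map (λ y → sumₚ (map (λ x → f x y) xs) d) ys)
    ≡⟨ sym (sumₚ-apply (λ y → sumₚ (map (λ x → f x y) xs)) ys d) ⟩
  sumₚ (map (λ y → sumₚ (map (λ x → f x y) xs)) ys) d ∎

-- Products in which each term changes at most one factor

module _ {I E : Set} (_≟ᴵ_ : DecidableEquality I) (es : List E)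
         (f : I → Poly) (g : E → I → Poly) (changed : E → I)
         (g≈f : ∀ e i → i ≢ changed e → g e i ≈ₚ f i)
         (sum-g : ∀ i → sumₚ (map (λ e → g e i) es) ≈ₚ shiftedEuler (+ length es - + 1) (f i))
  where

  private
    N : ℤ
    N = + length es

    P : List I → Poly
    P is = prodₚ (map f is)

    Pₑ : E → List I → Poly
    Pₑ e is = prodₚ (map (g e) is)

    Pₑ≈P : ∀ e is → All (_≢ changed e) is → Pₑ e is ≈ₚ P is
    Pₑ≈P e []       []             _ = refl
    Pₑ≈P e (i ∷ is) (i≢c ∷ is≢c) = *ₚ-cong (g≈f e i i≢c) (Pₑ≈P e is is≢c)

    -- (g e a − f a) (Pₑ e is − P is) = 0, as g e and f differ at most at changed e.
    change-one-factor : ∀ e a is → All (a ≢_) is → ∀ d →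
      (g e a *ₚ Pₑ e is) d ≡ (f a *ₚ Pₑ e is) d + (g e a *ₚ P is) d - (f a *ₚ P is) d
    change-one-factor e a is a∉is d with a ≟ᴵ changed e
    ... | yes a≡c = begin
      (g e a *ₚ Pₑ e is) d
        ≡⟨ *ₚ-congˡ (g e a) Pₑ≈P′ d ⟩
      (g e a *ₚ P is) d
        ≡⟨ sym (cancelˡ ((f a *ₚ P is) d) ((g e a *ₚ P is) d)) ⟩
      (f a *ₚ P is) d + (g e a *ₚ P is) d - (f a *ₚ P is) d
        ≡⟨ cong (λ x → x + (g e a *ₚ P is) d - (f a *ₚ P is) d) (*ₚ-congˡ (f a) Pₑ≈P′ d) ⟨
      (f a *ₚ Pₑ e is) d + (g e a *ₚ P is) d - (f a *ₚ P is) d ∎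
      where
      Pₑ≈P′ : Pₑ e is ≈ₚ P is
      Pₑ≈P′ = Pₑ≈P e is (All.map (λ a≢i i≡c → a≢i (trans a≡c (sym i≡c))) a∉is)
      cancelˡ : ∀ x y → x + y - x ≡ y
      cancelˡ = solve-∀
    ... | no a≢c = begin
      (g e a *ₚ Pₑ e is) d
        ≡⟨ *ₚ-congʳ (Pₑ e is) (g≈f e a a≢c) d ⟩
      (f a *ₚ Pₑ e is) d
        ≡⟨ sym (cancelʳ ((f a *ₚ Pₑ e is) d) ((f a *ₚ P is) d)) ⟩
      (f a *ₚ Pₑ e is) d + (f a *ₚ P is) d - (f a *ₚ P is) d
        ≡⟨ cong (λ x → (f a *ₚ Pₑ e is) d + x - (f a *ₚ P is) d) (*ₚ-congʳ (P is) (g≈f e a a≢c) d) ⟨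
      (f a *ₚ Pₑ e is) d + (g e a *ₚ P is) d - (f a *ₚ P is) d ∎
      where
      cancelʳ : ∀ x y → x + y - y ≡ x
      cancelʳ = solve-∀

  sumₚ-prodₚ-shiftedEuler : ∀ is → Unique is →
    sumₚ (map (λ e → prodₚ (map (g e) is)) es) ≈ₚ shiftedEuler (+ length es - + length is) (prodₚ (map f is))
  sumₚ-prodₚ-shiftedEuler [] [] d = begin
    sumₚ (map (λ _ → constₚ (+ 1)) es) d     ≡⟨ sumₚ-apply (λ _ → constₚ (+ 1)) es d ⟩
    sumℤ (map (λ _ → constₚ (+ 1) d) es)    ≡⟨ sumℤ-map-const (constₚ (+ 1) d) es ⟩
    N * constₚ (+ 1) d                      ≡⟨ pad N (constₚ (+ 1) d) ⟩
    (N - + 0) * constₚ (+ 1) d + + 0        ≡⟨ cong (_+_ ((N - + 0) * constₚ (+ 1) d)) (euler-constₚ (+ 1) d) ⟨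
    shiftedEuler (N - + 0) (constₚ (+ 1)) d ∎
    where
    pad : ∀ N x → N * x ≡ (N - + 0) * x + + 0
    pad = solve-∀
  sumₚ-prodₚ-shiftedEuler (a ∷ is) (a∉is ∷ unique) d = begin
    sumₚ (map (λ e → g e a *ₚ Pₑ e is) es) d
      ≡⟨ sumₚ-apply (λ e → g e a *ₚ Pₑ e is) es d ⟩
    sumℤ (map (λ e → (g e a *ₚ Pₑ e is) d) es)
      ≡⟨ sumℤ-map-cong (λ e → change-one-factor e a is a∉is d) es ⟩
    sumℤ (map (λ e → (f a *ₚ Pₑ e is) d + (g e a *ₚ P is) d - fP) es)
      ≡⟨ sumℤ-map-- (λ e → (f a *ₚ Pₑ e is) d + (g e a *ₚ P is) d) (λ _ → fP) es ⟩
    sumℤ (map (λ e → (f a *ₚ Pₑ e is) d + (g e a *ₚ P is) d) es) - sumℤ (map (λ _ → fP) es)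
      ≡⟨ cong₂ _-_ (sumℤ-map-+ (λ e → (f a *ₚ Pₑ e is) d) (λ e → (g e a *ₚ P is) d) es)
                   (sumℤ-map-const fP es) ⟩
    sumℤ (map (λ e → (f a *ₚ Pₑ e is) d) es) + sumℤ (map (λ e → (g e a *ₚ P is) d) es) - N * fP
      ≡⟨ cong₂ (λ x y → x + y - N * fP) factor-f factor-P ⟩
    (f a *ₚ sumₚ (map (λ e → Pₑ e is) es)) d + (sumₚ (map (λ e → g e a) es) *ₚ P is) d - N * fP
      ≡⟨ cong₂ (λ x y → x + y - N * fP) (*ₚ-congˡ (f a) (sumₚ-prodₚ-shiftedEuler is unique) d)
                                         (*ₚ-congʳ (P is) (sum-g a) d) ⟩
    (f a *ₚ shiftedEuler (N - ℓ) (P is)) d + (shiftedEuler (N - + 1) (f a) *ₚ P is) d - N * fP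
      ≡⟨ cong (λ x → x - N * fP) product-rule ⟩
    shiftedEuler ((N - + 1) + (N - ℓ)) (f a *ₚ P is) d - N * fP
      ≡⟨ collect N ℓ fP (+ d * fP) ⟩
    shiftedEuler (N - (+ 1 + ℓ)) (f a *ₚ P is) d ∎
    where
    ℓ fP : ℤ
    ℓ = + length is
    fP = (f a *ₚ P is) d
    product-rule : (f a *ₚ shiftedEuler (N - ℓ) (P is)) d + (shiftedEuler (N - + 1) (f a) *ₚ P is) d
                 ≡ shiftedEuler ((N - + 1) + (N - ℓ)) (f a *ₚ P is) d
    product-rule = trans (ℤ.+-comm ((f a *ₚ shiftedEuler (N - ℓ) (P is)) d) _)
                         (sym (shiftedEuler-*ₚ (N - + 1) (N - ℓ) (f a) (P is) d))
    factor-f : sumℤ (map (λ e → (f a *ₚ Pₑ e is) d) es) ≡ (f a *ₚ sumₚ (map (λ e → Pₑ e is) es)) d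
    factor-f = sym (trans (*ₚ-sumₚ (f a) (λ e → Pₑ e is) es d) (sumₚ-apply (λ e → f a *ₚ Pₑ e is) es d))
    factor-P : sumℤ (map (λ e → (g e a *ₚ P is) d) es) ≡ (sumₚ (map (λ e → g e a) es) *ₚ P is) d
    factor-P = sym (trans (sumₚ-*ₚ (P is) (λ e → g e a) es d) (sumₚ-apply (λ e → g e a *ₚ P is) es d))
    collect : ∀ N ℓ x D → ((N - + 1) + (N - ℓ)) * x + D - N * x ≡ (N - (+ 1 + ℓ)) * x + D
    collect = solve-∀

xI : ∀ {n} → Fin n → Fin n → Poly
xI i j = if ⌊ i ≟ j ⌋ then Xₚ else 0ₚ

euler-xI : ∀ {n} (i j : Fin n) → euler (xI i j) ≈ₚ xI i j
euler-xI i j with ⌊ i ≟ j ⌋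
... | true  = euler-Xₚ
... | false = λ d → ℤ.*-zeroʳ (+ d)

δ : ∀ {n} → Fin n → Fin n → ℤ
δ i j = 𝟙 ⌊ i ≟ j ⌋

module _ {n : ℕ} where

  δ-refl : ∀ (i : Fin n) → δ i i ≡ + 1
  δ-refl i with i ≟ i
  ... | yes _  = refl
  ... | no i≢i = ⊥-elim (i≢i refl)

  δ-≢ : ∀ {i j : Fin n} → i ≢ j → δ i j ≡ + 0
  δ-≢ {i} {j} i≢j with i ≟ j
  ... | yes i≡j = ⊥-elim (i≢j i≡j)
  ... | no _    = refl

  δ-sym : ∀ (i j : Fin n) → δ i j ≡ δ j i
  δ-sym i j with i ≟ j | j ≟ i
  ... | yes _   | yes _   = refl
  ... | no _    | no _    = refl
  ... | yes i≡j | no j≢i  = ⊥-elim (j≢i (sym i≡j))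
  ... | no i≢j  | yes j≡i = ⊥-elim (i≢j (sym j≡i))

  sum-δ-unique : ∀ (i : Fin n) (c : Fin n → ℤ) {xs} → Unique xs → i ∈ xs →
    sumℤ (map (λ x → δ i x * c x) xs) ≡ c i
  sum-δ-unique i c {_ ∷ xs} (i∉xs ∷ _) (here refl) = begin
    δ i i * c i + sumℤ (map (λ x → δ i x * c x) xs)
      ≡⟨ cong₂ _+_ (cong (_* c i) (δ-refl i)) (sumℤ-map-vanishing (All.map (λ {x} i≢x → cong (_* c x) (δ-≢ i≢x)) i∉xs)) ⟩
    + 1 * c i + + 0  ≡⟨ ℤ.+-identityʳ _ ⟩
    + 1 * c i        ≡⟨ ℤ.*-identityˡ (c i) ⟩
    c i ∎
  sum-δ-unique i c {x ∷ xs} (x∉xs ∷ unique) (there i∈xs) = begin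
    δ i x * c x + sumℤ (map (λ y → δ i y * c y) xs)  ≡⟨ cong (λ δix → δix * c x + _) (δ-≢ i≢x) ⟩
    + 0 + sumℤ (map (λ y → δ i y * c y) xs)          ≡⟨ ℤ.+-identityˡ _ ⟩
    sumℤ (map (λ y → δ i y * c y) xs)                ≡⟨ sum-δ-unique i c unique i∈xs ⟩
    c i ∎
    where
    i≢x : i ≢ x
    i≢x i≡x = All.lookup x∉xs i∈xs (sym i≡x)

  sum-δ : ∀ (i : Fin n) (c : Fin n → ℤ) → sumℤ (map (λ x → δ i x * c x) (allFin n)) ≡ c i
  sum-δ i c = sum-δ-unique i c (allFin⁺ n) (∈-allFin i)

inDeg-as-sum : ∀ {n} (G : Digraph n) j → + inDeg G j ≡ sumℤ (map (λ i → adjM G i j) (allFin n))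
inDeg-as-sum {n} G j = countᵇ-as-sumℤ (λ i → G i j) (allFin n)

module _ {n : ℕ} (G : Digraph n) where

  sum-arcs : ∀ (h : Fin n × Fin n → ℤ) →
    sumℤ (map h (arcs G)) ≡ sumℤ (map (λ u → sumℤ (map (λ v → adjM G u v * h (u , v)) (allFin n))) (allFin n))
  sum-arcs h =
    trans (sumℤ-filterᵇ _ h (concatMap (λ u → map (u ,_) (allFin n)) (allFin n)))
          (trans (sumℤ-concatMap _ (λ u → map (u ,_) (allFin n)) (allFin n))
                 (sumℤ-map-cong (λ u → cong sumℤ (sym (List.map-∘ (allFin n)))) (allFin n)))

  deleteArc-unchanged : ∀ u v i j → (i ≡ u → j ≢ v) → deleteArc G (u , v) i j ≡ G i j
  deleteArc-unchanged u v i j h with i ≟ u | j ≟ v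
  ... | yes i≡u | yes j≡v = ⊥-elim (h i≡u j≡v)
  ... | yes _   | no _    = ∧-identityʳ (G i j)
  ... | no _    | _       = ∧-identityʳ (G i j)

  adjM-deleteArc : ∀ u v i j → adjM G i j - adjM (deleteArc G (u , v)) i j ≡ (δ i u * δ j v) * adjM G i j
  adjM-deleteArc u v i j =
    trans (𝟙-∧-not (G i j) (⌊ i ≟ u ⌋ ∧ ⌊ j ≟ v ⌋)) (cong (_* adjM G i j) (𝟙-∧ ⌊ i ≟ u ⌋ ⌊ j ≟ v ⌋))

  inDeg-deleteArc : ∀ u v j → + inDeg G j - + inDeg (deleteArc G (u , v)) j ≡ δ j v * adjM G u j
  inDeg-deleteArc u v j = begin
    + inDeg G j - + inDeg (deleteArc G (u , v)) j
      ≡⟨ cong₂ _-_ (inDeg-as-sum G j) (inDeg-as-sum (deleteArc G (u , v)) j) ⟩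
    sumℤ (map (λ i → adjM G i j) (allFin n)) - sumℤ (map (λ i → adjM (deleteArc G (u , v)) i j) (allFin n))
      ≡⟨ sumℤ-map-- (λ i → adjM G i j) (λ i → adjM (deleteArc G (u , v)) i j) (allFin n) ⟨
    sumℤ (map (λ i → adjM G i j - adjM (deleteArc G (u , v)) i j) (allFin n))
      ≡⟨ sumℤ-map-cong (λ i → trans (adjM-deleteArc u v i j) (rearrange i)) (allFin n) ⟩
    sumℤ (map (λ i → δ j v * (δ u i * adjM G i j)) (allFin n))
      ≡⟨ sumℤ-map-*ˡ (δ j v) (λ i → δ u i * adjM G i j) (allFin n) ⟩
    δ j v * sumℤ (map (λ i → δ u i * adjM G i j) (allFin n))
      ≡⟨ cong (δ j v *_) (sum-δ u (λ i → adjM G i j)) ⟩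
    δ j v * adjM G u j ∎
    where
    swap : ∀ a b c → (a * b) * c ≡ b * (a * c)
    swap = solve-∀
    rearrange : ∀ i → (δ i u * δ j v) * adjM G i j ≡ δ j v * (δ u i * adjM G i j)
    rearrange i = trans (swap (δ i u) (δ j v) (adjM G i j)) (cong (λ x → δ j v * (x * adjM G i j)) (δ-sym i u))

  sum-adjM-deleteArc : ∀ i j → sumℤ (map (λ e → adjM G i j - adjM (deleteArc G e) i j) (arcs G)) ≡ adjM G i j
  sum-adjM-deleteArc i j = begin
    sumℤ (map (λ e → adjM G i j - adjM (deleteArc G e) i j) (arcs G))
      ≡⟨ sum-arcs (λ e → adjM G i j - adjM (deleteArc G e) i j) ⟩
    sumℤ (map (λ u → sumℤ (map (λ v → adjM G u v * (adjM G i j - adjM (deleteArc G (u , v)) i j)) (allFin n))) (allFin n))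
      ≡⟨ sumℤ-map-cong (λ u → sumℤ-map-cong (λ v → rearrange u v) (allFin n)) (allFin n) ⟩
    sumℤ (map (λ u → sumℤ (map (λ v → δ i u * (δ j v * (adjM G u v * adjM G i j))) (allFin n))) (allFin n))
      ≡⟨ sumℤ-map-cong (λ u → trans (sumℤ-map-*ˡ (δ i u) _ (allFin n))
                                     (cong (δ i u *_) (sum-δ j (λ v → adjM G u v * adjM G i j)))) (allFin n) ⟩
    sumℤ (map (λ u → δ i u * (adjM G u j * adjM G i j)) (allFin n))
      ≡⟨ sum-δ i (λ u → adjM G u j * adjM G i j) ⟩
    adjM G i j * adjM G i j
      ≡⟨ 𝟙-idem (G i j) ⟩
    adjM G i j ∎
    where
    regroup : ∀ a x y b → a * ((x * y) * b) ≡ x * (y * (a * b))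
    regroup = solve-∀
    rearrange : ∀ u v → adjM G u v * (adjM G i j - adjM (deleteArc G (u , v)) i j)
                      ≡ δ i u * (δ j v * (adjM G u v * adjM G i j))
    rearrange u v = trans (cong (adjM G u v *_) (adjM-deleteArc u v i j))
                          (regroup (adjM G u v) (δ i u) (δ j v) (adjM G i j))

  sum-inDeg-deleteArc : ∀ j →
    sumℤ (map (λ e → + inDeg G j - + inDeg (deleteArc G e) j) (arcs G)) ≡ + inDeg G j
  sum-inDeg-deleteArc j = begin
    sumℤ (map (λ e → + inDeg G j - + inDeg (deleteArc G e) j) (arcs G))
      ≡⟨ sum-arcs (λ e → + inDeg G j - + inDeg (deleteArc G e) j) ⟩
    sumℤ (map (λ u → sumℤ (map (λ v → adjM G u v * (+ inDeg G j - + inDeg (deleteArc G (u , v)) j)) (allFin n))) (allFin n))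
      ≡⟨ sumℤ-map-cong (λ u → sumℤ-map-cong (λ v → rearrange u v) (allFin n)) (allFin n) ⟩
    sumℤ (map (λ u → sumℤ (map (λ v → δ j v * (adjM G u v * adjM G u j)) (allFin n))) (allFin n))
      ≡⟨ sumℤ-map-cong (λ u → trans (sum-δ j (λ v → adjM G u v * adjM G u j)) (𝟙-idem (G u j))) (allFin n) ⟩
    sumℤ (map (λ u → adjM G u j) (allFin n))
      ≡⟨ inDeg-as-sum G j ⟨
    + inDeg G j ∎
    where
    regroup : ∀ a x b → a * (x * b) ≡ x * (a * b)
    regroup = solve-∀
    rearrange : ∀ u v → adjM G u v * (+ inDeg G j - + inDeg (deleteArc G (u , v)) j)
                      ≡ δ j v * (adjM G u v * adjM G u j)
    rearrange u v = trans (cong (adjM G u v *_) (inDeg-deleteArc u v j))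
                          (regroup (adjM G u v) (δ j v) (adjM G u j))

  sum-degM-deleteArc : ∀ i j → sumℤ (map (λ e → degM G i j - degM (deleteArc G e) i j) (arcs G)) ≡ degM G i j
  sum-degM-deleteArc i j with i ≟ j
  ... | yes refl = sum-inDeg-deleteArc i
  ... | no _     = sumℤ-map-0 (arcs G)

  sum-matrix-deleteArc : ∀ M i j →
    sumℤ (map (λ e → matrix M G i j - matrix M (deleteArc G e) i j) (arcs G)) ≡ matrix M G i j
  sum-matrix-deleteArc A i j = sum-adjM-deleteArc i j
  sum-matrix-deleteArc L i j =
    trans (sumℤ-map-cong (λ e → regroup (degM G i j) (adjM G i j) (degM (deleteArc G e) i j) (adjM (deleteArc G e) i j))
                         (arcs G))
          (trans (sumℤ-map-- lostDeg lostAdj (arcs G))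
                 (cong₂ _-_ (sum-degM-deleteArc i j) (sum-adjM-deleteArc i j)))
    where
    lostDeg lostAdj : Fin n × Fin n → ℤ
    lostDeg e = degM G i j - degM (deleteArc G e) i j
    lostAdj e = adjM G i j - adjM (deleteArc G e) i j
    regroup : ∀ d a d′ a′ → (d - a) - (d′ - a′) ≡ (d - d′) - (a - a′)
    regroup = solve-∀
  sum-matrix-deleteArc Q i j =
    trans (sumℤ-map-cong (λ e → regroup (degM G i j) (adjM G i j) (degM (deleteArc G e) i j) (adjM (deleteArc G e) i j))
                         (arcs G))
          (trans (sumℤ-map-+ lostDeg lostAdj (arcs G))
                 (cong₂ _+_ (sum-degM-deleteArc i j) (sum-adjM-deleteArc i j)))
    where
    lostDeg lostAdj : Fin n × Fin n → ℤ
    lostDeg e = degM G i j - degM (deleteArc G e) i j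
    lostAdj e = adjM G i j - adjM (deleteArc G e) i j
    regroup : ∀ d a d′ a′ → (d + a) - (d′ + a′) ≡ (d - d′) + (a - a′)
    regroup = solve-∀

  inDeg-deleteArc-unchanged : ∀ u v j → j ≢ v → + inDeg (deleteArc G (u , v)) j ≡ + inDeg G j
  inDeg-deleteArc-unchanged u v j j≢v =
    sym (ℤ.i-j≡0⇒i≡j _ _ (trans (inDeg-deleteArc u v j) (cong (_* adjM G u j) (δ-≢ j≢v))))

  degM-deleteArc-unchanged : ∀ u v i j → (i ≡ j → j ≢ v) → degM (deleteArc G (u , v)) i j ≡ degM G i j
  degM-deleteArc-unchanged u v i j h with i ≟ j
  ... | yes refl = inDeg-deleteArc-unchanged u v i (h refl)
  ... | no _     = refl

  matrix-deleteArc-unchanged : ∀ M u v i j → (i ≡ u → j ≢ v) → (i ≡ j → j ≢ v) →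
    matrix M (deleteArc G (u , v)) i j ≡ matrix M G i j
  matrix-deleteArc-unchanged A u v i j h₁ h₂ = cong 𝟙 (deleteArc-unchanged u v i j h₁)
  matrix-deleteArc-unchanged L u v i j h₁ h₂ =
    cong₂ _-_ (degM-deleteArc-unchanged u v i j h₂) (cong 𝟙 (deleteArc-unchanged u v i j h₁))
  matrix-deleteArc-unchanged Q u v i j h₁ h₂ =
    cong₂ _+_ (degM-deleteArc-unchanged u v i j h₂) (cong 𝟙 (deleteArc-unchanged u v i j h₁))

  charMatrix-deleteArc-unchanged : ∀ M u v i j → (i ≡ u → j ≢ v) → (i ≡ j → j ≢ v) →
    charMatrix M (deleteArc G (u , v)) i j ≈ₚ charMatrix M G i j
  charMatrix-deleteArc-unchanged M u v i j h₁ h₂ d =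
    cong (λ m → xI i j d + constₚ (- m) d) (matrix-deleteArc-unchanged M u v i j h₁ h₂)

  charMatrix-deleteArc : ∀ M e i j →
    charMatrix M (deleteArc G e) i j ≈ₚ charMatrix M G i j +ₚ constₚ (matrix M G i j - matrix M (deleteArc G e) i j)
  charMatrix-deleteArc M e i j d = begin
    xI i j d + constₚ (- m′) d                        ≡⟨ cong (λ c → xI i j d + constₚ c d) (cancel m m′) ⟨
    xI i j d + constₚ (- m + (m - m′)) d              ≡⟨ cong (_+_ (xI i j d)) (constₚ-+ (- m) (m - m′) d) ⟩
    xI i j d + (constₚ (- m) d + constₚ (m - m′) d)   ≡⟨ ℤ.+-assoc (xI i j d) _ _ ⟨
    xI i j d + constₚ (- m) d + constₚ (m - m′) d     ∎
    where
    m m′ : ℤ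
    m = matrix M G i j
    m′ = matrix M (deleteArc G e) i j
    cancel : ∀ m m′ → - m + (m - m′) ≡ - m′
    cancel = solve-∀

  euler-charMatrix : ∀ M i j → euler (charMatrix M G i j) ≈ₚ charMatrix M G i j +ₚ constₚ (matrix M G i j)
  euler-charMatrix M i j d = begin
    + d * (xI i j d + constₚ (- m) d)              ≡⟨ ℤ.*-distribˡ-+ (+ d) (xI i j d) (constₚ (- m) d) ⟩
    + d * xI i j d + + d * constₚ (- m) d          ≡⟨ cong₂ _+_ (euler-xI i j d) (euler-constₚ (- m) d) ⟩
    xI i j d + + 0                                 ≡⟨ cong (_+_ (xI i j d)) cancel ⟨
    xI i j d + constₚ (- m + m) d                  ≡⟨ cong (_+_ (xI i j d)) (constₚ-+ (- m) m d) ⟩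
    xI i j d + (constₚ (- m) d + constₚ m d)       ≡⟨ ℤ.+-assoc (xI i j d) _ _ ⟨
    xI i j d + constₚ (- m) d + constₚ m d         ∎
    where
    m : ℤ
    m = matrix M G i j
    cancel : constₚ (- m + m) d ≡ + 0
    cancel = trans (cong (λ c → constₚ c d) (ℤ.+-inverseˡ m)) (constₚ-zero d)

  sum-charMatrix-deleteArc : ∀ M i j →
    sumₚ (map (λ e → charMatrix M (deleteArc G e) i j) (arcs G)) ≈ₚ shiftedEuler (+ length (arcs G) - + 1) (charMatrix M G i j)
  sum-charMatrix-deleteArc M i j d = begin
    sumₚ (map (λ e → charMatrix M (deleteArc G e) i j) (arcs G)) d
      ≡⟨ sumₚ-apply (λ e → charMatrix M (deleteArc G e) i j) (arcs G) d ⟩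
    sumℤ (map (λ e → charMatrix M (deleteArc G e) i j d) (arcs G))
      ≡⟨ sumℤ-map-cong (λ e → charMatrix-deleteArc M e i j d) (arcs G) ⟩
    sumℤ (map (λ e → c d + constₚ (removed e) d) (arcs G))
      ≡⟨ sumℤ-map-+ (λ _ → c d) (λ e → constₚ (removed e) d) (arcs G) ⟩
    sumℤ (map (λ _ → c d) (arcs G)) + sumℤ (map (λ e → constₚ (removed e) d) (arcs G))
      ≡⟨ cong₂ _+_ (sumℤ-map-const (c d) (arcs G)) (sumℤ-map-constₚ removed (arcs G) d) ⟩
    N * c d + constₚ (sumℤ (map removed (arcs G))) d
      ≡⟨ cong (λ r → N * c d + constₚ r d) (sum-matrix-deleteArc M i j) ⟩
    N * c d + constₚ (matrix M G i j) d
      ≡⟨ split N (c d) (constₚ (matrix M G i j) d) ⟩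
    (N - + 1) * c d + (c d + constₚ (matrix M G i j) d)
      ≡⟨ cong (_+_ ((N - + 1) * c d)) (euler-charMatrix M i j d) ⟨
    shiftedEuler (N - + 1) c d ∎
    where
    N : ℤ
    N = + length (arcs G)
    c : Poly
    c = charMatrix M G i j
    removed : Fin n × Fin n → ℤ
    removed e = matrix M G i j - matrix M (deleteArc G e) i j
    split : ∀ N x y → N * x + y ≡ (N - + 1) * x + (x + y)
    split = solve-∀

allᵇ-∈ : ∀ {A : Set} (p : A → Bool) xs {x} → allᵇ p xs ≡ true → x ∈ xs → p x ≡ true
allᵇ-∈ p (y ∷ ys) all-p x∈ with p y in py | x∈
... | true  | here refl  = py
... | true  | there x∈ys = allᵇ-∈ p ys all-p x∈ys
... | false | _          = contradiction all-p λ ()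

isInjective-sound : ∀ {n} (σ : Fin n → Fin n) → isInjective σ ≡ true → Injective _≡_ _≡_ σ
isInjective-sound {n} σ injective {i} {j} σi≡σj with i ≟ j | σ i ≟ σ j | row-i-col-j
  where
  row-i-col-j : ⌊ i ≟ j ⌋ ∨ not ⌊ σ i ≟ σ j ⌋ ≡ true
  row-i-col-j = allᵇ-∈ _ (allFin n) (allᵇ-∈ _ (allFin n) injective (∈-allFin i)) (∈-allFin j)
... | yes i≡j | _        | _ = i≡j
... | no _    | no σi≢σj | _ = contradiction σi≡σj σi≢σj

-- Deleting (u , v) can only change the entries (u , v) and (v , v); the graph of an injective σ
-- meets at most one of them, in row v when σ fixes v and in row u otherwise.
changedRow : ∀ {n} → (Fin n → Fin n) → Fin n × Fin n → Fin n
changedRow σ (u , v) = if ⌊ σ v ≟ v ⌋ then v else u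

charMatrix-deleteArc-outside-changedRow : ∀ {n} M (G : Digraph n) (σ : Fin n → Fin n) → Injective _≡_ _≡_ σ →
  ∀ e i → i ≢ changedRow σ e → charMatrix M (deleteArc G e) i (σ i) ≈ₚ charMatrix M G i (σ i)
charMatrix-deleteArc-outside-changedRow M G σ σ-inj (u , v) i i≢c with σ v ≟ v
... | yes σv≡v = charMatrix-deleteArc-unchanged G M u v i (σ i)
                   (λ _ σi≡v → i≢c (σ-inj (trans σi≡v (sym σv≡v))))
                   (λ i≡σi σi≡v → i≢c (trans i≡σi σi≡v))
... | no σv≢v  = charMatrix-deleteArc-unchanged G M u v i (σ i)
                   (λ i≡u _ → i≢c i≡u)
                   (λ i≡σi σi≡v → σv≢v (trans (cong σ (sym (trans i≡σi σi≡v))) σi≡v))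

permutationProduct : ∀ {n} → MatKind → Digraph n → (Fin n → Fin n) → Poly
permutationProduct {n} M G σ = prodₚ (map (λ i → charMatrix M G i (σ i)) (allFin n))

sum-permutationProduct-deleteArc : ∀ {n} M (G : Digraph n) (σ : Fin n → Fin n) → Injective _≡_ _≡_ σ →
  sumₚ (map (λ e → permutationProduct M (deleteArc G e) σ) (arcs G))
    ≈ₚ shiftedEuler (+ length (arcs G) - + n) (permutationProduct M G σ)
sum-permutationProduct-deleteArc {n} M G σ σ-inj d =
  trans (sumₚ-prodₚ-shiftedEuler _≟_ (arcs G)
           (λ i → charMatrix M G i (σ i)) (λ e i → charMatrix M (deleteArc G e) i (σ i)) (changedRow σ)
           (charMatrix-deleteArc-outside-changedRow M G σ σ-inj) (λ i → sum-charMatrix-deleteArc G M i (σ i))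
           (allFin n) (allFin⁺ n) d)
        (cong (λ ℓ → shiftedEuler (+ length (arcs G) - + ℓ) (permutationProduct M G σ) d)
              (List.length-tabulate {n = n} id))

immanantTerm : ∀ {n} → MatKind → ℕ → Digraph n → (Fin n → Fin n) → Poly
immanantTerm {n} M k G σ = if isInjective σ then χhook n k σ ·ₚ permutationProduct M G σ else 0ₚ

sum-immanantTerm-deleteArc : ∀ {n} M k (G : Digraph n) σ →
  sumₚ (map (λ e → immanantTerm M k (deleteArc G e) σ) (arcs G))
    ≈ₚ shiftedEuler (+ length (arcs G) - + n) (immanantTerm M k G σ)
sum-immanantTerm-deleteArc {n} M k G σ d with isInjective σ in injective
... | true  =
  trans (sumₚ-·ₚ χ (λ e → permutationProduct M (deleteArc G e) σ) (arcs G) d)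
        (trans (cong (χ *_) (sum-permutationProduct-deleteArc M G σ (isInjective-sound σ injective) d))
               (shiftedEuler-·ₚ c χ (permutationProduct M G σ) d))
  where
  χ c : ℤ
  χ = χhook n k σ
  c = + length (arcs G) - + n
... | false =
  trans (sumₚ-apply (λ _ → 0ₚ) (arcs G) d)
        (trans (sumℤ-map-0 (arcs G)) (zeros (+ length (arcs G) - + n) (+ d)))
  where
  zeros : ∀ c D → + 0 ≡ c * + 0 + D * + 0
  zeros = solve-∀

theorem1 : (n : ℕ) (G : Digraph n) → Loopless G → (k : ℕ) → 1 ≤ k → k ≤ n → (M : MatKind) →
    (d : ℕ) →
      (((+ length (arcs G) - + n) ·ₚ Φ M k G) +ₚ (Xₚ *ₚ deriv (Φ M k G))) d
        ≡ sumₚ (map (λ e → Φ M k (deleteArc G e)) (arcs G)) d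
theorem1 n G _ k _ _ M d = begin
  c * Φ M k G d + (Xₚ *ₚ deriv (Φ M k G)) d
    ≡⟨ cong (_+_ (c * Φ M k G d)) (Xₚ-*ₚ-deriv (Φ M k G) d) ⟩
  shiftedEuler c (Φ M k G) d
    ≡⟨ sumₚ-shiftedEuler c (immanantTerm M k G) (allMaps n) d ⟨
  sumₚ (map (λ σ → shiftedEuler c (immanantTerm M k G σ)) (allMaps n)) d
    ≡⟨ sumₚ-map-cong (sum-immanantTerm-deleteArc M k G) (allMaps n) d ⟨
  sumₚ (map (λ σ → sumₚ (map (λ e → immanantTerm M k (deleteArc G e) σ) (arcs G))) (allMaps n)) d
    ≡⟨ sumₚ-swap (λ σ e → immanantTerm M k (deleteArc G e) σ) (allMaps n) (arcs G) d ⟩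
  sumₚ (map (λ e → Φ M k (deleteArc G e)) (arcs G)) d ∎
  where
  c : ℤ
  c = + length (arcs G) - + n
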